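{- Let $p>3$ be a prime and, for nonnegative integers $n\ge k$, let $$F(n,k)=(-1)^{n+k}\frac{6n-2k+1}{2^{9n-3k}}\cdot\frac{(2n+2k)!\,(2n-2k)!\,\binom{2n-2k}{n-k}}{(n+k)!\,(n-k)!\,n!^2}.$$ Then $$F(p-1,p-1)\equiv-3p^2\left(1+4p-6pq_p(2)\right)\pmod{p^4}.$$
   Context: $q_p(2)=(2^{p-1}-1)/p$ is the Fermat quotient. Congruences between rationals with denominators coprime to $p$ are understood in the ring of rationals with denominator prime to $p$. -}

module Defs where

open import Data.Nat as ℕ using (ℕ; _+_; _*_; _∸_; _^_; _!; NonZero)
open import Data.Nat.Properties using (_!≢0; m*n≢0; m^n≢0)
open import Data.Nat.Combinatorics using (_C_)
open import Data.Nat.Divisibility using (_∣_)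
open import Data.Integer as ℤ using (ℤ; +_)
open import Data.Rational as ℚ using (ℚ; ↧ₙ_)
open import Data.Product using (∃; _×_)
open import Relation.Nullary using (¬_)
open import Relation.Binary.PropositionalEquality using (_≡_)

ℕ→ℚ : ℕ → ℚ
ℕ→ℚ n = (+ n) ℚ./ 1

-- F(n,k) = (-1)^(n+k) (6n-2k+1)/2^(9n-3k) * (2n+2k)!(2n-2k)! C(2n-2k,n-k) / ((n+k)!(n-k)! n!^2)
-- (intended for n ≥ k, where truncated subtraction ∸ is ordinary subtraction)
F : ℕ → ℕ → ℚ
F n k =
  (ℚ._/_ ((ℤ.- (+ 1)) ℤ.^ (n + k) ℤ.* (+ (6 * n ∸ 2 * k + 1)))
     (2 ^ (9 * n ∸ 3 * k)) {{m^n≢0 2 (9 * n ∸ 3 * k)}})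
  ℚ.* (ℚ._/_ (+ ((2 * n + 2 * k) ! * (2 * n ∸ 2 * k) ! * ((2 * n ∸ 2 * k) C (n ∸ k))))
     ((n + k) ! * (n ∸ k) ! * ((n !) ^ 2))
         {{m*n≢0 _ _ {{m*n≢0 _ _ {{(n + k) !≢0}} {{(n ∸ k) !≢0}}}}
                     {{m^n≢0 (n !) 2 {{n !≢0}}}}}})

q₂ : (p : ℕ) → .{{NonZero p}} → ℚ
q₂ p = (+ (2 ^ (p ∸ 1) ∸ 1)) ℚ./ p

pIntegral : ℕ → ℚ → Set
pIntegral p x = ¬ (p ∣ ↧ₙ x)

-- x ≡ y (mod p^m) in the ring of rationals with denominator prime to p
CongModPow : ℕ → ℕ → ℚ → ℚ → Set
CongModPow p m x y = ∃ λ z → pIntegral p z × (x ℚ.- y ≡ ℕ→ℚ (p ^ m) ℚ.* z)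

module Submission where

-- With m = p − 1, F(m,m) = (4p−3)(4p−4)! / (2^{6m} (2p−2)! (m!)²). Splitting (4p−1)! at 3p and
-- (3p−1)! at 2p gives (4p−1)(4p−3)(4p−4)! = 3p² (2p−2)! ∏(3p+i) ∏(2p+i), the products over
-- i = 1, …, m. Each ∏(ap+i) is m! mod p²: as a polynomial in x = ap its linear coefficient is
-- divisible by p, because at x = −p it takes the value ∏(i−p) = (−1)^m m! = m!. Hence
-- F(m,m) ≡ 3p² / ((4p−1) 2^{6m}) mod p⁴, and writing 2^m = 1 + T with T = p q_p(2), the claim
-- becomes the polynomial congruence (1+4p−6T)(4p−1)(1+T)⁶ ≡ −1 mod p².

module Fermat where
  open import Data.Nat as ℕ
  open import Data.Nat.Properties
  open import Data.Nat.Combinatorics using (_C_; nCk≡n!/k![n-k]!; nCn≡1; k![n∸k]!∣n!)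
  open import Data.Nat.Divisibility
  open import Data.Nat.DivMod using (m/n*n≡m)
  open import Data.Nat.Primality using (Prime; euclidsLemma; prime⇒nonTrivial; prime⇒irreducible)
  open import Data.Fin as Fin using (Fin; toℕ; fromℕ; inject₁)
  open import Data.Fin.Properties using (toℕ-inject₁; toℕ<n; toℕ-fromℕ)
  open import Data.Sum using (_⊎_; inj₁; inj₂)
  open import Function using (_∘_)
  open import Relation.Binary.PropositionalEquality
  open import Relation.Nullary using (contradiction)
  import Algebra.Properties.CommutativeSemiring.Binomial +-*-commutativeSemiring as Binomial
  open import Algebra.Properties.Monoid.Sum +-0-monoid using (sum; sum-cong-≗; sum-init-last)
  open import Algebra.Definitions.RawMonoid +-0-rawMonoid using (_×_)
  open import Algebra.Definitions.RawSemiring +-*-rawSemiring using () renaming (_^_ to _^ˢ_)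

  ^ˢ≡^ : ∀ x k → x ^ˢ k ≡ x ^ k
  ^ˢ≡^ x zero    = refl
  ^ˢ≡^ x (suc k) = cong (x *_) (^ˢ≡^ x k)

  n×1≡n : ∀ n → n × 1 ≡ n
  n×1≡n zero    = refl
  n×1≡n (suc n) = cong suc (n×1≡n n)

  2^n≡∑nCk : ∀ n → 2 ^ n ≡ sum (λ (k : Fin (suc n)) → n C toℕ k)
  2^n≡∑nCk n = trans (sym (^ˢ≡^ 2 n)) (trans (Binomial.theorem n 1 1) (sum-cong-≗ term≡nCk))
    where
    1^ˢk≡1 : ∀ k → 1 ^ˢ k ≡ 1
    1^ˢk≡1 k = trans (^ˢ≡^ 1 k) (^-zeroˡ k)
    term≡nCk : ∀ k → Binomial.binomialTerm 1 1 n k ≡ n C toℕ k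
    term≡nCk k = trans (cong ((n C toℕ k) ×_) (cong₂ _*_ (1^ˢk≡1 (toℕ k)) (1^ˢk≡1 (n ∸ toℕ k))))
                       (n×1≡n (n C toℕ k))

  ∣-sum : ∀ {d n} (f : Fin n → ℕ) → (∀ i → d ∣ f i) → d ∣ sum f
  ∣-sum {n = zero}  f d∣f = _ ∣0
  ∣-sum {n = suc n} f d∣f = ∣m∣n⇒∣m+n (d∣f Fin.zero) (∣-sum (f ∘ Fin.suc) (d∣f ∘ Fin.suc))

  prime∤* : ∀ {p m n} → Prime p → p ∤ m → p ∤ n → p ∤ m * n
  prime∤* {m = m} {n} pr p∤m p∤n p∣mn with euclidsLemma m n pr p∣mn
  ... | inj₁ p∣m = p∤m p∣m
  ... | inj₂ p∣n = p∤n p∣n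

  prime∤1 : ∀ {p} → Prime p → p ∤ 1
  prime∤1 {p} pr = >⇒∤ (nonTrivial⇒n>1 p {{prime⇒nonTrivial pr}})

  prime∤! : ∀ {p k} → Prime p → k < p → p ∤ k !
  prime∤! {k = zero}  pr _   = prime∤1 pr
  prime∤! {k = suc k} pr k<p = prime∤* pr (>⇒∤ k<p) (prime∤! pr (<-trans (n<1+n k) k<p))

  prime∤2^ : ∀ {p} → Prime p → 2 < p → ∀ k → p ∤ 2 ^ k
  prime∤2^ pr 2<p zero    = prime∤1 pr
  prime∤2^ pr 2<p (suc k) = prime∤* pr (>⇒∤ 2<p) (prime∤2^ pr 2<p k)

  prime∣pCk : ∀ {p k} → Prime p → 0 < k → k < p → p ∣ p C k
  prime∣pCk {p@(suc n)} {k} pr 0<k k<p with euclidsLemma (p C k) (k ! * (p ∸ k) !) pr p∣pCk*k![p∸k]!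
    where
    instance _ = k !* (p ∸ k) !≢0
    pCk*k![p∸k]!≡p! : (p C k) * (k ! * (p ∸ k) !) ≡ p !
    pCk*k![p∸k]!≡p! = trans (cong (_* (k ! * (p ∸ k) !)) (nCk≡n!/k![n-k]! (<⇒≤ k<p)))
                            (m/n*n≡m (k![n∸k]!∣n! (<⇒≤ k<p)))
    p∣pCk*k![p∸k]! : p ∣ (p C k) * (k ! * (p ∸ k) !)
    p∣pCk*k![p∸k]! = subst (p ∣_) (sym pCk*k![p∸k]!≡p!) (m∣m*n (n !))
  ... | inj₁ p∣pCk  = p∣pCk
  ... | inj₂ p∣k![p∸k]! =
    contradiction p∣k![p∸k]! (prime∤* pr (prime∤! pr k<p) (prime∤! pr (∸-monoʳ-< 0<k (<⇒≤ k<p))))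

  prime∣2^p∸2 : ∀ {p} → Prime p → p ∣ 2 ^ p ∸ 2
  prime∣2^p∸2 {suc m} pr =
    subst (suc m ∣_) (sym 2^p∸2≡∑middle) (∣-sum middle (λ j → prime∣pCk pr z<s (s<s (middle-index< j))))
    where
    upper : Fin (suc m) → ℕ
    upper j = suc m C suc (toℕ j)
    middle : Fin m → ℕ
    middle j = upper (inject₁ j)
    middle-index< : ∀ j → toℕ (inject₁ j) < m
    middle-index< j = subst (_< m) (sym (toℕ-inject₁ j)) (toℕ<n j)
    open ≡-Reasoning
    2^p∸2≡∑middle : 2 ^ suc m ∸ 2 ≡ sum middle
    2^p∸2≡∑middle = begin
      2 ^ suc m ∸ 2                                 ≡⟨ cong (_∸ 2) (2^n≡∑nCk (suc m)) ⟩
      1 + sum upper ∸ 2                             ≡⟨ cong (λ s → 1 + s ∸ 2) (sum-init-last upper) ⟩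
      sum middle + suc m C suc (toℕ (fromℕ m)) ∸ 1  ≡⟨ cong (λ k → sum middle + suc m C suc k ∸ 1) (toℕ-fromℕ m) ⟩
      sum middle + suc m C suc m ∸ 1                ≡⟨ cong (λ c → sum middle + c ∸ 1) (nCn≡1 (suc m)) ⟩
      sum middle + 1 ∸ 1                            ≡⟨ m+n∸n≡m (sum middle) 1 ⟩
      sum middle                                    ∎

  odd-prime∣2^[p-1]∸1 : ∀ {m} → Prime (suc m) → 2 < suc m → suc m ∣ 2 ^ m ∸ 1
  odd-prime∣2^[p-1]∸1 {m} pr 2<p
    with euclidsLemma 2 (2 ^ m ∸ 1) pr (subst (suc m ∣_) (sym (*-distribˡ-∸ 2 (2 ^ m) 1)) (prime∣2^p∸2 pr))
  ... | inj₁ p∣2       = contradiction p∣2 (>⇒∤ 2<p)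
  ... | inj₂ p∣2^m∸1  = p∣2^m∸1

  even⊎odd : ∀ n → 2 ∣ n ⊎ 2 ∣ suc n
  even⊎odd zero = inj₁ (2 ∣0)
  even⊎odd (suc n) with even⊎odd n
  ... | inj₁ 2∣n   = inj₂ (∣m∣n⇒∣m+n ∣-refl 2∣n)
  ... | inj₂ 2∣1+n = inj₁ 2∣1+n

  odd-prime⇒2∣[p-1] : ∀ {m} → Prime (suc m) → 2 < suc m → 2 ∣ m
  odd-prime⇒2∣[p-1] {m} pr 2<p with even⊎odd m
  ... | inj₁ 2∣m = 2∣m
  ... | inj₂ 2∣p with prime⇒irreducible pr 2∣p
  ...   | inj₁ ()
  ...   | inj₂ 2≡p = contradiction 2≡p (<⇒≢ 2<p)

module Rising where
  open import Data.Nat as ℕ using (ℕ; zero; suc; _!)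
  import Data.Nat.Properties as ℕP
  open import Data.Nat.Divisibility using (_∣_; divides)
  open import Data.Integer hiding (suc)
  open import Data.Integer.Properties
  open import Data.Integer.Tactic.RingSolver using (solve-∀)
  open import Data.Product using (∃; _,_; proj₁; proj₂)
  open import Relation.Binary.PropositionalEquality

  -1^even : ∀ {n} → 2 ∣ n → -1ℤ ^ n ≡ 1ℤ
  -1^even (divides q refl) = trans (cong (-1ℤ ^_) (ℕP.*-comm q 2)) (trans (sym (^-*-assoc -1ℤ 2 q)) (^-zeroˡ q))

  pos-^ : ∀ a k → + (a ℕ.^ k) ≡ (+ a) ^ k
  pos-^ a zero    = refl
  pos-^ a (suc k) = trans (pos-* a (a ℕ.^ k)) (cong (+ a *_) (pos-^ a k))

  +[a+b*m] : ∀ a b m → + (a ℕ.+ b ℕ.* m) ≡ + a + + b * + m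
  +[a+b*m] a b m = trans (pos-+ a (b ℕ.* m)) (cong (λ n → + a + n) (pos-* b m))

  rise : ℤ → ℕ → ℤ
  rise x zero    = 1ℤ
  rise x (suc k) = rise x k * (x + + suc k)

  riseSlope : ℕ → ℤ
  riseSlope zero    = 0ℤ
  riseSlope (suc k) = riseSlope k * + suc k + + (k !)

  riseRemainder : ℤ → ℕ → ℤ
  riseRemainder x zero    = 0ℤ
  riseRemainder x (suc k) = riseSlope k + riseRemainder x k * (x + + suc k)

  rise-expansion : ∀ x k → rise x k ≡ + (k !) + x * riseSlope k + x * x * riseRemainder x k
  rise-expansion x zero = expand x
    where
    expand : ∀ x → 1ℤ ≡ 1ℤ + x * 0ℤ + x * x * 0ℤ
    expand = solve-∀
  rise-expansion x (suc k) = begin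
    rise x k * (x + s)                ≡⟨ cong (_* (x + s)) (rise-expansion x k) ⟩
    (c + x * e + x * x * r) * (x + s) ≡⟨ regroup c x e r s ⟩
    c * s + x * (e * s + c) + x * x * (e + r * (x + s))
      ≡⟨ cong (λ t → t + x * (e * s + c) + x * x * (e + r * (x + s))) c*s≡[1+k]! ⟩
    + (suc k !) + x * riseSlope (suc k) + x * x * riseRemainder x (suc k) ∎
    where
    open ≡-Reasoning
    s = + suc k
    c = + (k !)
    e = riseSlope k
    r = riseRemainder x k
    regroup : ∀ c x e r s → (c + x * e + x * x * r) * (x + s) ≡ c * s + x * (e * s + c) + x * x * (e + r * (x + s))
    regroup = solve-∀
    c*s≡[1+k]! : c * s ≡ + (suc k !)
    c*s≡[1+k]! = trans (*-comm c s) (sym (pos-* (suc k) (k !)))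

  rise-shift : ∀ x k → rise x (suc k) ≡ (x + 1ℤ) * rise (x + 1ℤ) k
  rise-shift x zero    = *-comm 1ℤ (x + 1ℤ)
  rise-shift x (suc k) = begin
    rise x (suc k) * (x + + suc (suc k))            ≡⟨ cong₂ _*_ (rise-shift x k) x+[2+k]≡[x+1]+[1+k] ⟩
    (x + 1ℤ) * rise (x + 1ℤ) k * (x + 1ℤ + + suc k) ≡⟨ *-assoc (x + 1ℤ) _ _ ⟩
    (x + 1ℤ) * rise (x + 1ℤ) (suc k)                ∎
    where
    open ≡-Reasoning
    x+[2+k]≡[x+1]+[1+k] : x + + suc (suc k) ≡ x + 1ℤ + + suc k
    x+[2+k]≡[x+1]+[1+k] = trans (cong (λ n → x + n) (pos-+ 1 (suc k))) (sym (+-assoc x 1ℤ (+ suc k)))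

  rise-reflect : ∀ k → rise (- + suc k) k ≡ -1ℤ ^ k * + (k !)
  rise-reflect zero    = refl
  rise-reflect (suc k) = begin
    rise (- + suc (suc k)) (suc k)                         ≡⟨ rise-shift (- + suc (suc k)) k ⟩
    (- + suc (suc k) + 1ℤ) * rise (- + suc (suc k) + 1ℤ) k ≡⟨ cong (λ y → y * rise y k) -[2+k]+1≡-[1+k] ⟩
    - + suc k * rise (- + suc k) k                         ≡⟨ cong (- + suc k *_) (rise-reflect k) ⟩
    - + suc k * (-1ℤ ^ k * + (k !))                        ≡⟨ regroup (+ suc k) (-1ℤ ^ k) (+ (k !)) ⟩
    -1ℤ ^ suc k * (+ suc k * + (k !))                      ≡⟨ cong (-1ℤ ^ suc k *_) (sym (pos-* (suc k) (k !))) ⟩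
    -1ℤ ^ suc k * + (suc k !)                              ∎
    where
    open ≡-Reasoning
    -[1+n]+1≡-n : ∀ n → - (1ℤ + n) + 1ℤ ≡ - n
    -[1+n]+1≡-n = solve-∀
    -[2+k]+1≡-[1+k] : - + suc (suc k) + 1ℤ ≡ - + suc k
    -[2+k]+1≡-[1+k] = trans (cong (λ y → - y + 1ℤ) (pos-+ 1 (suc k))) (-[1+n]+1≡-n (+ suc k))
    regroup : ∀ n s f → - n * (s * f) ≡ -1ℤ * s * (n * f)
    regroup = solve-∀

  -- For even m, rise-reflect makes rise (−p) m equal to the constant term m! of its expansion,
  -- so p · riseSlope m = p² · riseRemainder (−p) m.
  riseSlope≡[1+m]*riseRemainder : ∀ {m} → 2 ∣ m → riseSlope m ≡ + suc m * riseRemainder (- + suc m) m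
  riseSlope≡[1+m]*riseRemainder {m} 2∣m = *-cancelˡ-≡ p e (p * r) (begin
    p * e                                               ≡⟨ isolate c p e r ⟩
    p * (p * r) - ((c + - p * e + - p * - p * r) - c) ≡⟨ cong (λ y → p * (p * r) - (y - c)) (sym c≡expansion) ⟩
    p * (p * r) - (c - c)                               ≡⟨ cancel p r c ⟩
    p * (p * r)                                         ∎)
    where
    open ≡-Reasoning
    p = + suc m
    c = + (m !)
    e = riseSlope m
    r = riseRemainder (- p) m
    c≡expansion : c ≡ c + - p * e + - p * - p * r
    c≡expansion = begin
      c                            ≡⟨ sym (*-identityˡ c) ⟩
      1ℤ * c                       ≡⟨ cong (_* c) (sym (-1^even 2∣m)) ⟩
      -1ℤ ^ m * c                  ≡⟨ sym (rise-reflect m) ⟩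
      rise (- p) m                 ≡⟨ rise-expansion (- p) m ⟩
      c + - p * e + - p * - p * r  ∎
    isolate : ∀ c p e r → p * e ≡ p * (p * r) - ((c + - p * e + - p * - p * r) - c)
    isolate = solve-∀
    cancel : ∀ p r c → p * (p * r) - (c - c) ≡ p * (p * r)
    cancel = solve-∀

  rise[ap]≡m!+p²u : ∀ {m} → 2 ∣ m → ∀ a → ∃ λ u → rise (a * + suc m) m ≡ + (m !) + + suc m * + suc m * u
  rise[ap]≡m!+p²u {m} 2∣m a = a * r + a * a * r′ , (begin
    rise (a * p) m                                  ≡⟨ rise-expansion (a * p) m ⟩
    c + a * p * riseSlope m + a * p * (a * p) * r′
      ≡⟨ cong (λ e → c + a * p * e + a * p * (a * p) * r′) (riseSlope≡[1+m]*riseRemainder 2∣m) ⟩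
    c + a * p * (p * r) + a * p * (a * p) * r′      ≡⟨ regroup c a p r r′ ⟩
    c + p * p * (a * r + a * a * r′)                ∎)
    where
    open ≡-Reasoning
    p = + suc m
    c = + (m !)
    r = riseRemainder (- p) m
    r′ = riseRemainder (a * p) m
    regroup : ∀ c a p r r′ → c + a * p * (p * r) + a * p * (a * p) * r′ ≡ c + p * p * (a * r + a * a * r′)
    regroup = solve-∀

  [a+k]!≡a!*rise : ∀ a k → + ((a ℕ.+ k) !) ≡ + (a !) * rise (+ a) k
  [a+k]!≡a!*rise a zero    = trans (cong (λ n → + (n !)) (ℕP.+-identityʳ a)) (sym (*-identityʳ (+ (a !))))
  [a+k]!≡a!*rise a (suc k) = begin
    + ((a ℕ.+ suc k) !)                         ≡⟨ cong (λ n → + (n !)) (ℕP.+-suc a k) ⟩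
    + (suc (a ℕ.+ k) ℕ.* (a ℕ.+ k) !)           ≡⟨ pos-* (suc (a ℕ.+ k)) ((a ℕ.+ k) !) ⟩
    + suc (a ℕ.+ k) * + ((a ℕ.+ k) !)           ≡⟨ cong₂ _*_ +[1+a+k]≡+a++[1+k] ([a+k]!≡a!*rise a k) ⟩
    (+ a + + suc k) * (+ (a !) * rise (+ a) k)  ≡⟨ regroup (+ a + + suc k) (+ (a !)) (rise (+ a) k) ⟩
    + (a !) * rise (+ a) (suc k)                ∎
    where
    open ≡-Reasoning
    +[1+a+k]≡+a++[1+k] : + suc (a ℕ.+ k) ≡ + a + + suc k
    +[1+a+k]≡+a++[1+k] = trans (cong +_ (sym (ℕP.+-suc a k))) (pos-+ a (suc k))
    regroup : ∀ x y z → x * (y * z) ≡ y * (z * x)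
    regroup = solve-∀

  [2+k]!≡[2+k][1+k]k! : ∀ k → + ((2 ℕ.+ k) !) ≡ + (2 ℕ.+ k) * (+ (1 ℕ.+ k) * + (k !))
  [2+k]!≡[2+k][1+k]k! k = trans (pos-* (2 ℕ.+ k) ((1 ℕ.+ k) !)) (cong (+ (2 ℕ.+ k) *_) (pos-* (1 ℕ.+ k) (k !)))

  [3+k]!≡[3+k][2+k][1+k]k! : ∀ k → + ((3 ℕ.+ k) !) ≡ + (3 ℕ.+ k) * (+ (2 ℕ.+ k) * (+ (1 ℕ.+ k) * + (k !)))
  [3+k]!≡[3+k][2+k][1+k]k! k = trans (pos-* (3 ℕ.+ k) ((2 ℕ.+ k) !)) (cong (+ (3 ℕ.+ k) *_) ([2+k]!≡[2+k][1+k]k! k))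

  -- (3 + 4m)! computed factor by factor and by splitting at 3p and 2p, with p = m + 1.
  [4m]!-rise-identity : ∀ m →
    (+ 4 * + suc m - + 1) * (+ 4 * + suc m - + 3) * + ((4 ℕ.* m) !)
      ≡ + 3 * + suc m * + suc m * + ((2 ℕ.* m) !) * rise (+ 3 * + suc m) m * rise (+ 2 * + suc m) m
  [4m]!-rise-identity m = *-cancelˡ-≡ (+ (2 ℕ.+ 4 ℕ.* m)) _ _ (begin
    + (2 ℕ.+ 4 ℕ.* m) * ((+ 4 * p - + 1) * (+ 4 * p - + 3) * f₄)
      ≡⟨ cong₂ (λ a₂ p → a₂ * ((+ 4 * p - + 1) * (+ 4 * p - + 3) * f₄)) (+[a+b*m] 2 4 m) (pos-+ 1 m) ⟩
    (+ 2 + + 4 * M) * ((+ 4 * (+ 1 + M) - + 1) * (+ 4 * (+ 1 + M) - + 3) * f₄)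
      ≡⟨ regroupˡ M f₄ ⟩
    (+ 3 + + 4 * M) * ((+ 2 + + 4 * M) * ((+ 1 + + 4 * M) * f₄))
      ≡⟨ sym (cong₂ _*_ (+[a+b*m] 3 4 m) (cong₂ (λ a₂ a₁ → a₂ * (a₁ * f₄)) (+[a+b*m] 2 4 m) (+[a+b*m] 1 4 m))) ⟩
    + (3 ℕ.+ 4 ℕ.* m) * (+ (2 ℕ.+ 4 ℕ.* m) * (+ (1 ℕ.+ 4 ℕ.* m) * f₄))
      ≡⟨ sym ([3+k]!≡[3+k][2+k][1+k]k! (4 ℕ.* m)) ⟩
    + ((3 ℕ.+ 4 ℕ.* m) !)
      ≡⟨ [3+4m]!-by-rises ⟩
    + (3 ℕ.+ 3 ℕ.* m) * (+ (2 ℕ.+ 2 ℕ.* m) * (+ (1 ℕ.+ 2 ℕ.* m) * f₂) * r₂) * r₃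
      ≡⟨ cong₂ (λ a₃ b → a₃ * b * r₃) (+[a+b*m] 3 3 m)
               (cong₂ (λ a₂ a₁ → a₂ * (a₁ * f₂) * r₂) (+[a+b*m] 2 2 m) (+[a+b*m] 1 2 m)) ⟩
    (+ 3 + + 3 * M) * ((+ 2 + + 2 * M) * ((+ 1 + + 2 * M) * f₂) * r₂) * r₃
      ≡⟨ regroupʳ M f₂ r₂ r₃ ⟩
    (+ 2 + + 4 * M) * (+ 3 * (+ 1 + M) * (+ 1 + M) * f₂ * r₃ * r₂)
      ≡⟨ cong₂ (λ a₂ p → a₂ * (+ 3 * p * p * f₂ * r₃ * r₂)) (sym (+[a+b*m] 2 4 m)) (sym (pos-+ 1 m)) ⟩
    + (2 ℕ.+ 4 ℕ.* m) * (+ 3 * p * p * f₂ * r₃ * r₂)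
      ≡⟨ cong₂ (λ x y → + (2 ℕ.+ 4 ℕ.* m) * (+ 3 * p * p * f₂ * rise x m * rise y m))
               (+[a+am]≡a*p 3) (+[a+am]≡a*p 2) ⟩
    + (2 ℕ.+ 4 ℕ.* m) * (+ 3 * p * p * f₂ * rise (+ 3 * p) m * rise (+ 2 * p) m) ∎)
    where
    open ≡-Reasoning
    p = + suc m
    M = + m
    f₄ = + ((4 ℕ.* m) !)
    f₂ = + ((2 ℕ.* m) !)
    r₃ = rise (+ (3 ℕ.+ 3 ℕ.* m)) m
    r₂ = rise (+ (2 ℕ.+ 2 ℕ.* m)) m
    +[a+am]≡a*p : ∀ a → + (a ℕ.+ a ℕ.* m) ≡ + a * p
    +[a+am]≡a*p a = trans (cong +_ (sym (ℕP.*-suc a m))) (pos-* a (suc m))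
    a+[1+b]m≡a+bm+m : ∀ a b → a ℕ.+ suc b ℕ.* m ≡ a ℕ.+ b ℕ.* m ℕ.+ m
    a+[1+b]m≡a+bm+m a b = trans (cong (a ℕ.+_) (ℕP.+-comm m (b ℕ.* m))) (sym (ℕP.+-assoc a (b ℕ.* m) m))
    [3+4m]!-by-rises :
      + ((3 ℕ.+ 4 ℕ.* m) !) ≡ + (3 ℕ.+ 3 ℕ.* m) * (+ (2 ℕ.+ 2 ℕ.* m) * (+ (1 ℕ.+ 2 ℕ.* m) * f₂) * r₂) * r₃
    [3+4m]!-by-rises = begin
      + ((3 ℕ.+ 4 ℕ.* m) !)                          ≡⟨ cong (λ n → + (n !)) (a+[1+b]m≡a+bm+m 3 3) ⟩
      + ((3 ℕ.+ 3 ℕ.* m ℕ.+ m) !)                    ≡⟨ [a+k]!≡a!*rise (3 ℕ.+ 3 ℕ.* m) m ⟩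
      + ((3 ℕ.+ 3 ℕ.* m) !) * r₃                     ≡⟨ cong (_* r₃) (pos-* (3 ℕ.+ 3 ℕ.* m) ((2 ℕ.+ 3 ℕ.* m) !)) ⟩
      + (3 ℕ.+ 3 ℕ.* m) * + ((2 ℕ.+ 3 ℕ.* m) !) * r₃ ≡⟨ cong (λ z → + (3 ℕ.+ 3 ℕ.* m) * z * r₃) [2+3m]!≡[2+2m]!*r₂ ⟩
      + (3 ℕ.+ 3 ℕ.* m) * (+ ((2 ℕ.+ 2 ℕ.* m) !) * r₂) * r₃
        ≡⟨ cong (λ z → + (3 ℕ.+ 3 ℕ.* m) * (z * r₂) * r₃) ([2+k]!≡[2+k][1+k]k! (2 ℕ.* m)) ⟩
      + (3 ℕ.+ 3 ℕ.* m) * (+ (2 ℕ.+ 2 ℕ.* m) * (+ (1 ℕ.+ 2 ℕ.* m) * f₂) * r₂) * r₃ ∎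
      where
      [2+3m]!≡[2+2m]!*r₂ : + ((2 ℕ.+ 3 ℕ.* m) !) ≡ + ((2 ℕ.+ 2 ℕ.* m) !) * r₂
      [2+3m]!≡[2+2m]!*r₂ = trans (cong (λ n → + (n !)) (a+[1+b]m≡a+bm+m 2 2)) ([a+k]!≡a!*rise (2 ℕ.+ 2 ℕ.* m) m)
    regroupˡ : ∀ M f → (+ 2 + + 4 * M) * ((+ 4 * (+ 1 + M) - + 1) * (+ 4 * (+ 1 + M) - + 3) * f)
                     ≡ (+ 3 + + 4 * M) * ((+ 2 + + 4 * M) * ((+ 1 + + 4 * M) * f))
    regroupˡ = solve-∀
    regroupʳ : ∀ M f r₂ r₃ → (+ 3 + + 3 * M) * ((+ 2 + + 2 * M) * ((+ 1 + + 2 * M) * f) * r₂) * r₃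
                            ≡ (+ 2 + + 4 * M) * (+ 3 * (+ 1 + M) * (+ 1 + M) * f * r₃ * r₂)
    regroupʳ = solve-∀

  central-factorial-congruence : ∀ {m} → 2 ∣ m → ∃ λ u →
    (+ 4 * + suc m - + 1) * (+ 4 * + suc m - + 3) * + ((4 ℕ.* m) !)
      ≡ + 3 * + suc m * + suc m * + ((2 ℕ.* m) !) * (+ (m !) * + (m !) + + suc m * + suc m * u)
  central-factorial-congruence {m} 2∣m = c * (u₂ + u₃) + p * p * u₃ * u₂ , (begin
    (+ 4 * p - + 1) * (+ 4 * p - + 3) * + ((4 ℕ.* m) !)    ≡⟨ [4m]!-rise-identity m ⟩
    + 3 * p * p * f₂ * rise (+ 3 * p) m * rise (+ 2 * p) m ≡⟨ cong₂ (λ x y → + 3 * p * p * f₂ * x * y) r₃≡ r₂≡ ⟩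
    + 3 * p * p * f₂ * (c + p * p * u₃) * (c + p * p * u₂) ≡⟨ regroup p f₂ c u₂ u₃ ⟩
    + 3 * p * p * f₂ * (c * c + p * p * (c * (u₂ + u₃) + p * p * u₃ * u₂)) ∎)
    where
    open ≡-Reasoning
    p = + suc m
    c = + (m !)
    f₂ = + ((2 ℕ.* m) !)
    u₃ = proj₁ (rise[ap]≡m!+p²u 2∣m (+ 3))
    r₃≡ = proj₂ (rise[ap]≡m!+p²u 2∣m (+ 3))
    u₂ = proj₁ (rise[ap]≡m!+p²u 2∣m (+ 2))
    r₂≡ = proj₂ (rise[ap]≡m!+p²u 2∣m (+ 2))
    regroup : ∀ p f c u₂ u₃ → + 3 * p * p * f * (c + p * p * u₃) * (c + p * p * u₂)
                            ≡ + 3 * p * p * f * (c * c + p * p * (c * (u₂ + u₃) + p * p * u₃ * u₂))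
    regroup = solve-∀

module Polynomial where
  open import Data.Integer
  open import Data.Integer.Tactic.RingSolver using (solve-∀; solve)
  open import Data.List using (_∷_; [])
  open import Data.Product using (∃; _,_)
  open import Relation.Binary.PropositionalEquality

  -- The solver does not unfold _^_, so the sixth power is written out.
  [1+T]^6-expansion : ∀ T → (1ℤ + T) ^ 6
    ≡ 1ℤ + + 6 * T + T * T * (+ 15 + + 20 * T + + 15 * (T * T) + + 6 * (T * T * T) + T * T * T * T)
  [1+T]^6-expansion = expand
    where
    expand : ∀ T → (1ℤ + T) * ((1ℤ + T) * ((1ℤ + T) * ((1ℤ + T) * ((1ℤ + T) * ((1ℤ + T) * 1ℤ)))))
      ≡ 1ℤ + + 6 * T + T * T * (+ 15 + + 20 * T + + 15 * (T * T) + + 6 * (T * T * T) + T * T * T * T)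
    expand = solve-∀

  -- factor-p² holds for every h, in particular for the cofactor of T² in (1 + T)⁶.
  sixth-power-congruence : ∀ P S → ∃ λ Q →
    1ℤ + (1ℤ + + 4 * P - + 6 * (P * S)) * (+ 4 * P - 1ℤ) * (1ℤ + P * S) ^ 6 ≡ P * P * Q
  sixth-power-congruence P S =
    _ , trans (cong (λ g → 1ℤ + (1ℤ + + 4 * P - + 6 * (P * S)) * (+ 4 * P - 1ℤ) * g) ([1+T]^6-expansion (P * S)))
              (factor-p² P S _)
    where
    factor-p² : ∀ P S h →
      1ℤ + (1ℤ + + 4 * P - + 6 * (P * S)) * (+ 4 * P - 1ℤ) * (1ℤ + + 6 * (P * S) + P * S * (P * S) * h)
      ≡ P * P * (S * S * (+ 36 - h + + 6 * P * S * h) + (+ 16 - + 24 * S) * (1ℤ + + 6 * (P * S) + P * S * (P * S) * h))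
    factor-p² = solve-∀

  -- For P = p, T = 2^m − 1, G = 2^{6m}, c = m!, f₂ = (2m)!, f₄ = (4m)! this is
  -- F(m,m) − target = p⁴ · w / ((4p−1) 2^{6m} (m!)²) with both sides over a common denominator.
  cross-multiplied-difference : ∀ P T G Q c f₂ f₄ u →
    (+ 4 * P - 1ℤ) * (+ 4 * P - + 3) * f₄ ≡ + 3 * P * P * f₂ * (c * c + P * P * u) →
    1ℤ + (1ℤ + + 4 * P - + 6 * T) * (+ 4 * P - 1ℤ) * G ≡ P * P * Q →
    ((+ 4 * P - + 3) * f₄ - - (+ 3 * P * P * (1ℤ + + 4 * P - + 6 * T)) * (G * (f₂ * (c * c))))
        * (G * (c * c) * (+ 4 * P - 1ℤ))
      ≡ P * P * P * P * (+ 3 * (u + Q * (c * c))) * (G * (f₂ * (c * c)))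
  cross-multiplied-difference P T G Q c f₂ f₄ u f₄-identity sixth-power = begin
    ((+ 4 * P - + 3) * f₄ - - (+ 3 * P * P * (1ℤ + + 4 * P - + 6 * T)) * (G * (f₂ * (c * c))))
        * (G * (c * c) * (+ 4 * P - 1ℤ))
      ≡⟨ solve (P ∷ T ∷ G ∷ c ∷ f₂ ∷ f₄ ∷ []) ⟩
    (+ 4 * P - 1ℤ) * (+ 4 * P - + 3) * f₄ * (G * (c * c))
      + + 3 * P * P * f₂ * (G * (c * c)) * ((1ℤ + (1ℤ + + 4 * P - + 6 * T) * (+ 4 * P - 1ℤ) * G - 1ℤ) * (c * c))
      ≡⟨ cong₂ (λ x y → x * (G * (c * c)) + + 3 * P * P * f₂ * (G * (c * c)) * ((y - 1ℤ) * (c * c)))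
               f₄-identity sixth-power ⟩
    + 3 * P * P * f₂ * (c * c + P * P * u) * (G * (c * c))
      + + 3 * P * P * f₂ * (G * (c * c)) * ((P * P * Q - 1ℤ) * (c * c))
      ≡⟨ solve (P ∷ G ∷ Q ∷ c ∷ f₂ ∷ u ∷ []) ⟩
    P * P * P * P * (+ 3 * (u + Q * (c * c))) * (G * (f₂ * (c * c))) ∎
    where open ≡-Reasoning

module Fractions where
  open import Data.Nat as ℕ using (ℕ; suc; NonZero; _!; _∸_; _^_)
  import Data.Nat.Properties as ℕP
  open import Data.Nat.Properties using (_!*_!≢0)
  open import Data.Nat.Combinatorics using (_C_)
  open import Data.Nat.Divisibility using (_∣_; _∤_; divides; ∣-trans)
  open import Data.Nat.GCD using (gcd)
  open import Data.Integer as ℤ using (ℤ; +_; 1ℤ)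
  import Data.Integer.Properties as ℤP
  open import Data.Rational as ℚ using (ℚ; _/_; toℚᵘ; ↧_; ↧ₙ_)
  import Data.Rational.Properties as ℚP
  open import Data.Rational.Unnormalised as ℚᵘ using (mkℚᵘ; *≡*) renaming (_/_ to _/ᵘ_)
  import Data.Rational.Unnormalised.Properties as ℚᵘP
  open import Data.Product using (_,_)
  open import Relation.Binary.PropositionalEquality
  open import Defs using (F; ℕ→ℚ; CongModPow)
  open Rising using (-1^even)

  toℚᵘ-/ : ∀ i n .{{_ : NonZero n}} → toℚᵘ (i / n) ℚᵘ.≃ (i /ᵘ n)
  toℚᵘ-/ i (suc n) = ℚP.toℚᵘ-fromℚᵘ (mkℚᵘ i n)

  /-≡-/ : ∀ a b c d .{{_ : NonZero b}} .{{_ : NonZero d}} → a ℤ.* + d ≡ c ℤ.* + b → a / b ≡ c / d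
  /-≡-/ a (suc b) c (suc d) ad≡cb = ℚP.fromℚᵘ-cong {mkℚᵘ a b} {mkℚᵘ c d} (*≡* ad≡cb)

  /-*-/ : ∀ a b c d .{{_ : NonZero b}} .{{_ : NonZero d}} →
          (a / b) ℚ.* (c / d) ≡ ((a ℤ.* c) / (b ℕ.* d)) {{ℕP.m*n≢0 b d}}
  /-*-/ a b@(suc _) c d@(suc _) = ℚP.toℚᵘ-injective (begin
    toℚᵘ ((a / b) ℚ.* (c / d))        ≈⟨ ℚP.toℚᵘ-homo-* (a / b) (c / d) ⟩
    toℚᵘ (a / b) ℚᵘ.* toℚᵘ (c / d)   ≈⟨ ℚᵘP.*-cong (toℚᵘ-/ a b) (toℚᵘ-/ c d) ⟩
    (a ℤ.* c) /ᵘ (b ℕ.* d)            ≈⟨ toℚᵘ-/ (a ℤ.* c) (b ℕ.* d) ⟨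
    toℚᵘ ((a ℤ.* c) / (b ℕ.* d))     ∎)
    where open ℚᵘP.≃-Reasoning

  /-+-/ : ∀ a b c d .{{_ : NonZero b}} .{{_ : NonZero d}} →
          (a / b) ℚ.+ (c / d) ≡ ((a ℤ.* + d ℤ.+ c ℤ.* + b) / (b ℕ.* d)) {{ℕP.m*n≢0 b d}}
  /-+-/ a b@(suc _) c d@(suc _) = ℚP.toℚᵘ-injective (begin
    toℚᵘ ((a / b) ℚ.+ (c / d))                   ≈⟨ ℚP.toℚᵘ-homo-+ (a / b) (c / d) ⟩
    toℚᵘ (a / b) ℚᵘ.+ toℚᵘ (c / d)              ≈⟨ ℚᵘP.+-cong (toℚᵘ-/ a b) (toℚᵘ-/ c d) ⟩
    (a ℤ.* + d ℤ.+ c ℤ.* + b) /ᵘ (b ℕ.* d)       ≈⟨ toℚᵘ-/ (a ℤ.* + d ℤ.+ c ℤ.* + b) (b ℕ.* d) ⟨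
    toℚᵘ ((a ℤ.* + d ℤ.+ c ℤ.* + b) / (b ℕ.* d)) ∎)
    where open ℚᵘP.≃-Reasoning

  -‿/ : ∀ a b .{{_ : NonZero b}} → ℚ.- (a / b) ≡ (ℤ.- a) / b
  -‿/ a b@(suc _) = ℚP.toℚᵘ-injective (begin
    toℚᵘ (ℚ.- (a / b))  ≈⟨ ℚP.toℚᵘ-homo‿- (a / b) ⟩
    ℚᵘ.- toℚᵘ (a / b)  ≈⟨ ℚᵘP.-‿cong (toℚᵘ-/ a b) ⟩
    (ℤ.- a) /ᵘ b        ≈⟨ toℚᵘ-/ (ℤ.- a) b ⟨
    toℚᵘ ((ℤ.- a) / b) ∎)
    where open ℚᵘP.≃-Reasoning

  ↧ₙ[i/n]∣n : ∀ i n .{{_ : NonZero n}} → ↧ₙ (i / n) ∣ n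
  ↧ₙ[i/n]∣n i n = divides (gcd ℤ.∣ i ∣ n) (ℤP.+-injective (begin
    + n                                    ≡⟨ ℚP.↧-/ i n ⟨
    ↧ (i / n) ℤ.* + gcd ℤ.∣ i ∣ n          ≡⟨ ℤP.*-comm (↧ (i / n)) (+ gcd ℤ.∣ i ∣ n) ⟩
    + gcd ℤ.∣ i ∣ n ℤ.* ↧ (i / n)          ≡⟨ ℤP.pos-* (gcd ℤ.∣ i ∣ n) (↧ₙ (i / n)) ⟨
    + (gcd ℤ.∣ i ∣ n ℕ.* ↧ₙ (i / n))       ∎))
    where open ≡-Reasoning

  CongModPow-intro : ∀ {p k x y} w d .{{_ : NonZero d}} → p ∤ d →
                     x ℚ.- y ≡ ℕ→ℚ (p ^ k) ℚ.* (w / d) → CongModPow p k x y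
  CongModPow-intro w d p∤d x-y≡pᵏz = w / d , (λ p∣↧ → p∤d (∣-trans p∣↧ (↧ₙ[i/n]∣n w d))) , x-y≡pᵏz

  -- Tracking an unreduced numerator and denominator turns equations between rational
  -- expressions into ring identities in ℤ.
  record IsFraction (x : ℚ) (a b : ℤ) : Set where
    constructor isFraction
    field
      den       : ℕ
      {{den≢0}} : NonZero den
      +den≡b    : + den ≡ b
      x≡a/den   : x ≡ a / den

  fraction : ∀ a n .{{_ : NonZero n}} → IsFraction (a / n) a (+ n)
  fraction a n@(suc _) = isFraction n refl refl

  fraction-cong : ∀ {x a a′ b b′} → a ≡ a′ → b ≡ b′ → IsFraction x a b → IsFraction x a′ b′
  fraction-cong refl refl fx = fx

  fraction-* : ∀ {x y a b c d} → IsFraction x a b → IsFraction y c d → IsFraction (x ℚ.* y) (a ℤ.* c) (b ℤ.* d)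
  fraction-* {a = a} {c = c} (isFraction m refl refl) (isFraction n refl refl) =
    isFraction (m ℕ.* n) {{ℕP.m*n≢0 m n}} (ℤP.pos-* m n) (/-*-/ a m c n)

  fraction-+ : ∀ {x y a b c d} → IsFraction x a b → IsFraction y c d →
               IsFraction (x ℚ.+ y) (a ℤ.* d ℤ.+ c ℤ.* b) (b ℤ.* d)
  fraction-+ {a = a} {c = c} (isFraction m refl refl) (isFraction n refl refl) =
    isFraction (m ℕ.* n) {{ℕP.m*n≢0 m n}} (ℤP.pos-* m n) (/-+-/ a m c n)

  fraction-neg : ∀ {x a b} → IsFraction x a b → IsFraction (ℚ.- x) (ℤ.- a) b
  fraction-neg {a = a} (isFraction m +m≡b refl) = isFraction m +m≡b (-‿/ a m)

  fraction-≡ : ∀ {x y a b c d} → IsFraction x a b → IsFraction y c d → a ℤ.* d ≡ c ℤ.* b → x ≡ y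
  fraction-≡ {a = a} {c = c} (isFraction m refl refl) (isFraction n refl refl) = /-≡-/ a m c n

  integer-+ : ∀ {x y a c} → IsFraction x a 1ℤ → IsFraction y c 1ℤ → IsFraction (x ℚ.+ y) (a ℤ.+ c) 1ℤ
  integer-+ {a = a} {c = c} fx fy =
    fraction-cong (cong₂ ℤ._+_ (ℤP.*-identityʳ a) (ℤP.*-identityʳ c)) refl (fraction-+ fx fy)

  integer-- : ∀ {x y a c} → IsFraction x a 1ℤ → IsFraction y c 1ℤ → IsFraction (x ℚ.- y) (a ℤ.- c) 1ℤ
  integer-- fx fy = integer-+ fx (fraction-neg fy)

  fraction⇒integer : ∀ {x a b c} → IsFraction x a b → a ≡ c ℤ.* b → IsFraction x c 1ℤ
  fraction⇒integer {a = a} {c = c} (isFraction m refl refl) a≡cm =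
    isFraction 1 refl (/-≡-/ a m c 1 (trans (ℤP.*-identityʳ a) a≡cm))

  integer-*-fraction : ∀ {x y a c d} → IsFraction x a 1ℤ → IsFraction y c d → IsFraction (x ℚ.* y) (a ℤ.* c) d
  integer-*-fraction fx fy = fraction-cong refl (ℤP.*-identityˡ _) (fraction-* fx fy)

  fraction-−-integer : ∀ {x y a b c} → IsFraction x a b → IsFraction y c 1ℤ →
                       IsFraction (x ℚ.- y) (a ℤ.- c ℤ.* b) b
  fraction-−-integer {a = a} {b} {c} fx fy =
    fraction-cong (cong₂ ℤ._+_ (ℤP.*-identityʳ a) (sym (ℤP.neg-distribˡ-* c b))) (ℤP.*-identityʳ b)
                  (fraction-+ fx (fraction-neg fy))

  F-diagonal : ∀ n → IsFraction (F n n) (+ (4 ℕ.* n ℕ.+ 1) ℤ.* + ((4 ℕ.* n) !))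
                                        (+ (2 ^ (6 ℕ.* n)) ℤ.* (+ ((2 ℕ.* n) !) ℤ.* (+ (n !) ℤ.* + (n !))))
  F-diagonal n = fraction-cong (cong₂ ℤ._*_ sign-and-factor central) (cong₂ ℤ._*_ power-of-2 factorials)
                   (fraction-* (fraction num₁ den₁) (fraction num₂ den₂))
    where
    num₁ = ℤ.-1ℤ ℤ.^ (n ℕ.+ n) ℤ.* + (6 ℕ.* n ∸ 2 ℕ.* n ℕ.+ 1)
    den₁ = 2 ^ (9 ℕ.* n ∸ 3 ℕ.* n)
    num₂ = + ((2 ℕ.* n ℕ.+ 2 ℕ.* n) ! ℕ.* (2 ℕ.* n ∸ 2 ℕ.* n) ! ℕ.* ((2 ℕ.* n ∸ 2 ℕ.* n) C (n ∸ n)))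
    den₂ = (n ℕ.+ n) ! ℕ.* (n ∸ n) ! ℕ.* ((n !) ^ 2)
    instance
      _ = ℕP.m^n≢0 2 (9 ℕ.* n ∸ 3 ℕ.* n)
      _ = ℕP.m*n≢0 ((n ℕ.+ n) ! ℕ.* (n ∸ n) !) ((n !) ^ 2)
                   {{(n ℕ.+ n) !* (n ∸ n) !≢0}} {{ℕP.m^n≢0 (n !) 2 {{n ℕP.!≢0}}}}
    n+n≡2*n : n ℕ.+ n ≡ 2 ℕ.* n
    n+n≡2*n = cong (n ℕ.+_) (sym (ℕP.+-identityʳ n))
    [a+b]n∸bn≡an : ∀ a b → (a ℕ.+ b) ℕ.* n ∸ b ℕ.* n ≡ a ℕ.* n
    [a+b]n∸bn≡an a b = trans (cong (_∸ b ℕ.* n) (ℕP.*-distribʳ-+ n a b)) (ℕP.m+n∸n≡m (a ℕ.* n) (b ℕ.* n))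
    sign-and-factor : num₁ ≡ + (4 ℕ.* n ℕ.+ 1)
    sign-and-factor =
      trans (cong₂ ℤ._*_ (-1^even (divides n (trans n+n≡2*n (ℕP.*-comm 2 n))))
                         (cong (λ k → + (k ℕ.+ 1)) ([a+b]n∸bn≡an 4 2)))
            (ℤP.*-identityˡ _)
    central : num₂ ≡ + ((4 ℕ.* n) !)
    central rewrite ℕP.n∸n≡0 (2 ℕ.* n) | ℕP.n∸n≡0 n =
      cong +_ (trans (ℕP.*-identityʳ _) (trans (ℕP.*-identityʳ _) (cong _! (sym (ℕP.*-distribʳ-+ n 2 2)))))
    power-of-2 : + den₁ ≡ + (2 ^ (6 ℕ.* n))
    power-of-2 = cong (λ k → + (2 ^ k)) ([a+b]n∸bn≡an 6 3)
    factorials : + den₂ ≡ + ((2 ℕ.* n) !) ℤ.* (+ (n !) ℤ.* + (n !))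
    factorials rewrite ℕP.n∸n≡0 n = begin
      + ((n ℕ.+ n) ! ℕ.* 1 ℕ.* ((n !) ^ 2))
        ≡⟨ cong +_ (cong₂ ℕ._*_ (trans (ℕP.*-identityʳ _) (cong _! n+n≡2*n))
                                (cong (n ! ℕ.*_) (ℕP.*-identityʳ (n !)))) ⟩
      + ((2 ℕ.* n) ! ℕ.* (n ! ℕ.* n !))          ≡⟨ ℤP.pos-* ((2 ℕ.* n) !) (n ! ℕ.* n !) ⟩
      + ((2 ℕ.* n) !) ℤ.* + (n ! ℕ.* n !)        ≡⟨ cong (+ ((2 ℕ.* n) !) ℤ.*_) (ℤP.pos-* (n !) (n !)) ⟩
      + ((2 ℕ.* n) !) ℤ.* (+ (n !) ℤ.* + (n !))  ∎
      where open ≡-Reasoning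

import Data.Nat as ℕ
open import Relation.Binary.PropositionalEquality using (_≡_)

module Diagonal (m s : ℕ.ℕ) (2^m∸1≡sp : 2 ℕ.^ m ℕ.∸ 1 ≡ s ℕ.* ℕ.suc m) where
  open import Data.Nat as ℕ using (ℕ; suc; NonZero; _!; _∸_; _^_; _<_)
  import Data.Nat.Properties as ℕP
  open import Data.Nat.Divisibility using (_∣_; _∤_; n∣m*n; ∣m+n∣m⇒∣n)
  open import Data.Nat.Primality using (Prime)
  open import Data.Integer as ℤ using (ℤ; +_; 1ℤ)
  import Data.Integer.Properties as ℤP
  open import Data.Integer.Tactic.RingSolver using (solve-∀)
  open import Data.Rational as ℚ using (ℚ; _/_)
  import Data.Nat.Tactic.RingSolver as ℕSolver
  open import Relation.Binary.PropositionalEquality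
  open import Data.Product using (proj₁; proj₂)
  open import Defs using (F; ℕ→ℚ; q₂; CongModPow)
  open Fermat using (prime∤*; prime∤1; prime∤!; prime∤2^; odd-prime⇒2∣[p-1])
  open Rising using (pos-^; central-factorial-congruence)
  open Polynomial using (sixth-power-congruence; cross-multiplied-difference)
  open Fractions

  p = suc m
  P = + p
  S = + s
  c = + (m !)
  f₂ = + ((2 ℕ.* m) !)
  f₄ = + ((4 ℕ.* m) !)
  G = (1ℤ ℤ.+ P ℤ.* S) ℤ.^ 6

  D : ℕ
  D = 2 ^ (6 ℕ.* m) ℕ.* (m ! ℕ.* m !) ℕ.* (3 ℕ.+ 4 ℕ.* m)

  instance
    D≢0 : NonZero D
    D≢0 = ℕP.m*n≢0 _ _ {{ℕP.m*n≢0 _ _ {{ℕP.m^n≢0 2 (6 ℕ.* m)}} {{ℕP._!*_!≢0 m m}}}}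

  +[2^m∸1]≡P*S : + (2 ^ m ∸ 1) ≡ P ℤ.* S
  +[2^m∸1]≡P*S = trans (cong +_ 2^m∸1≡sp) (trans (ℤP.pos-* s p) (ℤP.*-comm S P))

  +2^[6m]≡G : + (2 ^ (6 ℕ.* m)) ≡ G
  +2^[6m]≡G = begin
    + (2 ^ (6 ℕ.* m))              ≡⟨ cong (λ k → + (2 ^ k)) (ℕP.*-comm 6 m) ⟩
    + (2 ^ (m ℕ.* 6))              ≡⟨ cong +_ (ℕP.^-*-assoc 2 m 6) ⟨
    + ((2 ^ m) ^ 6)                ≡⟨ pos-^ (2 ^ m) 6 ⟩
    (+ (2 ^ m)) ℤ.^ 6              ≡⟨ cong (ℤ._^ 6) +2^m≡1+PS ⟩
    G                              ∎
    where
    open ≡-Reasoning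
    +2^m≡1+PS : + (2 ^ m) ≡ 1ℤ ℤ.+ P ℤ.* S
    +2^m≡1+PS = trans (cong +_ (sym (ℕP.m+[n∸m]≡n (ℕP.m^n>0 2 m))))
                      (trans (ℤP.pos-+ 1 (2 ^ m ∸ 1)) (cong (λ t → 1ℤ ℤ.+ t) +[2^m∸1]≡P*S))

  +[3+4m]≡4P-1 : + (3 ℕ.+ 4 ℕ.* m) ≡ + 4 ℤ.* P ℤ.- 1ℤ
  +[3+4m]≡4P-1 =
    trans (Rising.+[a+b*m] 3 4 m) (trans (shift (+ m)) (cong (λ x → + 4 ℤ.* x ℤ.- 1ℤ) (sym (ℤP.pos-+ 1 m))))
    where
    shift : ∀ M → + 3 ℤ.+ + 4 ℤ.* M ≡ + 4 ℤ.* (1ℤ ℤ.+ M) ℤ.- 1ℤ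
    shift = solve-∀

  F-fraction : IsFraction (F m m) ((+ 4 ℤ.* P ℤ.- + 3) ℤ.* f₄) (G ℤ.* (f₂ ℤ.* (c ℤ.* c)))
  F-fraction =
    fraction-cong (cong (ℤ._* f₄) +[4m+1]≡4P-3) (cong (ℤ._* (f₂ ℤ.* (c ℤ.* c))) +2^[6m]≡G) (F-diagonal m)
    where
    shift : ∀ M → + 4 ℤ.* M ℤ.+ + 1 ≡ + 4 ℤ.* (1ℤ ℤ.+ M) ℤ.- + 3
    shift = solve-∀
    +[4m+1]≡4P-3 : + (4 ℕ.* m ℕ.+ 1) ≡ + 4 ℤ.* P ℤ.- + 3
    +[4m+1]≡4P-3 = trans (ℤP.pos-+ (4 ℕ.* m) 1) (trans (cong (ℤ._+ + 1) (ℤP.pos-* 4 m))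
                     (trans (shift (+ m)) (cong (λ x → + 4 ℤ.* x ℤ.- + 3) (sym (ℤP.pos-+ 1 m)))))

  target : ℚ
  target = ℚ.- (ℕ→ℚ 3 ℚ.* ℕ→ℚ p ℚ.* ℕ→ℚ p ℚ.* (ℕ→ℚ 1 ℚ.+ ℕ→ℚ 4 ℚ.* ℕ→ℚ p ℚ.- ℕ→ℚ 6 ℚ.* ℕ→ℚ p ℚ.* q₂ p))

  target-fraction : IsFraction target (ℤ.- (+ 3 ℤ.* P ℤ.* P ℤ.* (1ℤ ℤ.+ + 4 ℤ.* P ℤ.- + 6 ℤ.* (P ℤ.* S)))) 1ℤ
  target-fraction =
    fraction-neg (fraction-* (fraction-* (fraction-* (integer 3) (integer p)) (integer p))
                             (integer-- (integer-+ (integer 1) (fraction-* (integer 4) (integer p))) 6pq₂-fraction))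
    where
    integer : ∀ n → IsFraction (ℕ→ℚ n) (+ n) 1ℤ
    integer n = fraction (+ n) 1
    regroup : ∀ P S → + 6 ℤ.* P ℤ.* (P ℤ.* S) ≡ + 6 ℤ.* (P ℤ.* S) ℤ.* (1ℤ ℤ.* P)
    regroup = solve-∀
    6pq₂-fraction : IsFraction (ℕ→ℚ 6 ℚ.* ℕ→ℚ p ℚ.* q₂ p) (+ 6 ℤ.* (P ℤ.* S)) 1ℤ
    6pq₂-fraction = fraction⇒integer (fraction-* (fraction-* (integer 6) (integer p)) (fraction (+ (2 ^ m ∸ 1)) p))
                      (trans (cong (+ 6 ℤ.* P ℤ.*_) +[2^m∸1]≡P*S) (regroup P S))

  scaled-fraction : ∀ w → IsFraction (ℕ→ℚ (p ^ 4) ℚ.* (w / D)) (P ℤ.* P ℤ.* P ℤ.* P ℤ.* w)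
                                     (G ℤ.* (c ℤ.* c) ℤ.* (+ 4 ℤ.* P ℤ.- 1ℤ))
  scaled-fraction w = fraction-cong (cong (ℤ._* w) +p⁴≡P⁴) +D≡denominator
                        (integer-*-fraction (fraction (+ (p ^ 4)) 1) (fraction w D))
    where
    fourth-power : ∀ x → x ℤ.* (x ℤ.* (x ℤ.* (x ℤ.* 1ℤ))) ≡ x ℤ.* x ℤ.* x ℤ.* x
    fourth-power = solve-∀
    +p⁴≡P⁴ : + (p ^ 4) ≡ P ℤ.* P ℤ.* P ℤ.* P
    +p⁴≡P⁴ = trans (pos-^ p 4) (fourth-power P)
    +D≡denominator : + D ≡ G ℤ.* (c ℤ.* c) ℤ.* (+ 4 ℤ.* P ℤ.- 1ℤ)
    +D≡denominator = trans (ℤP.pos-* (2 ^ (6 ℕ.* m) ℕ.* (m ! ℕ.* m !)) (3 ℕ.+ 4 ℕ.* m))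
      (cong₂ ℤ._*_ (trans (ℤP.pos-* (2 ^ (6 ℕ.* m)) (m ! ℕ.* m !)) (cong₂ ℤ._*_ +2^[6m]≡G (ℤP.pos-* (m !) (m !))))
                   +[3+4m]≡4P-1)

  prime∤D : Prime p → 2 < p → p ∤ D
  prime∤D pr 2<p =
    prime∤* pr (prime∤* pr (prime∤2^ pr 2<p (6 ℕ.* m)) (prime∤* pr (prime∤! pr m<p) (prime∤! pr m<p))) prime∤3+4m
    where
    m<p = ℕP.n<1+n m
    4p≡[3+4m]+1 : ∀ m → 4 ℕ.* suc m ≡ 3 ℕ.+ 4 ℕ.* m ℕ.+ 1
    4p≡[3+4m]+1 = ℕSolver.solve-∀
    prime∤3+4m : p ∤ 3 ℕ.+ 4 ℕ.* m
    prime∤3+4m p∣3+4m = prime∤1 pr (∣m+n∣m⇒∣n (subst (p ∣_) (4p≡[3+4m]+1 m) (n∣m*n 4)) p∣3+4m)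

  F≡target-mod-p⁴ : Prime p → 2 < p → CongModPow p 4 (F m m) target
  F≡target-mod-p⁴ pr 2<p =
    -- CongModPow unfolds during unification, so its arguments are given explicitly.
    CongModPow-intro {k = 4} {F m m} {target} w D (prime∤D pr 2<p)
      (fraction-≡ (fraction-−-integer F-fraction target-fraction) (scaled-fraction w)
                  (cross-multiplied-difference P (P ℤ.* S) G Q c f₂ f₄ u f₄-identity sixth-power))
    where
    2∣m = odd-prime⇒2∣[p-1] pr 2<p
    u = proj₁ (central-factorial-congruence 2∣m)
    f₄-identity = proj₂ (central-factorial-congruence 2∣m)
    Q = proj₁ (sixth-power-congruence P S)
    sixth-power = proj₂ (sixth-power-congruence P S)
    w = + 3 ℤ.* (u ℤ.+ Q ℤ.* (c ℤ.* c))

open import Defs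
open import Data.Nat using (ℕ; _∸_; _<_; NonZero)
open import Data.Nat.Primality using (Prime)
open import Data.Rational using (_+_; _-_; _*_; -_)
open import Data.Nat.Divisibility using (quotient; m∣n⇒n≡quotient*m)
open import Data.Nat.Properties using (<⇒≤)

lemma4p1 : (p : ℕ) .{{_ : NonZero p}} → Prime p → 3 < p →
    CongModPow p 4 (F (p ∸ 1) (p ∸ 1))
    (- (ℕ→ℚ 3 * ℕ→ℚ p * ℕ→ℚ p * (ℕ→ℚ 1 + ℕ→ℚ 4 * ℕ→ℚ p - ℕ→ℚ 6 * ℕ→ℚ p * q₂ p)))
lemma4p1 (ℕ.suc m) pr 3<p = F≡target-mod-p⁴ pr 2<p
  where
  2<p = <⇒≤ 3<p
  p∣2^m∸1 = Fermat.odd-prime∣2^[p-1]∸1 pr 2<p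
  open Diagonal m (quotient p∣2^m∸1) (m∣n⇒n≡quotient*m p∣2^m∸1)
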